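{- Let $\mathcal V$ be a variety of closure algebras containing $\mathbf 4$. Then $\mathbf 4^2$ is a $\mathcal V$-finitely presented unifiable algebra.
   Context: A closure algebra is a Boolean algebra with unary $\Diamond$ satisfying $\Diamond0=0$, $\Diamond(a\vee b)=\Diamond a\vee\Diamond b$, $a\le\Diamond a=\Diamond\Diamond a$. $\mathbf 4$ is the four-element closure algebra with atoms $a,\neg a$ where $\Diamond0=0$, $\Diamond a=1$, $\Diamond\neg a=\neg a$, $\Diamond1=1$. An algebra is $\mathcal V$-finitely presented if it is isomorphic to $\mathbf F(k)/\theta$ with $\mathbf F(k)$ the free algebra for $\mathcal V$ of finite rank $k$ and $\theta$ the congruence generated by finitely many pairs; it is unifiable if it admits a homomorphism into the free algebra for $\mathcal V$ of countably infinite rank. -}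

module Defs where

open import Level using (Level; 0ℓ; _⊔_) renaming (suc to lsuc)
open import Data.Bool using (Bool; true; false; not) renaming (_∨_ to _or_; _∧_ to _and_)
open import Data.Product using (_×_; _,_; proj₁; proj₂)
open import Data.Nat using (ℕ)
open import Data.Fin using (Fin)
open import Data.List using (List)
open import Data.List.Membership.Propositional using (_∈_)
open import Relation.Binary using (Rel; IsEquivalence)
open import Relation.Binary.PropositionalEquality using (_≡_) renaming (isEquivalence to ≡-isEquivalence)
open import Algebra.Lattice.Bundles using (BooleanAlgebra)

data Term (X : Set) : Set where
  var  : X → Term X
  `0   : Term X
  `1   : Term X
  _`∨_ : Term X → Term X → Term X
  _`∧_ : Term X → Term X → Term X
  `¬   : Term X → Term X
  `◇   : Term X → Term X

record RawCA c ℓ : Set (lsuc (c ⊔ ℓ)) where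
  field
    Carrier : Set c
    _≈_     : Rel Carrier ℓ
    isEquiv : IsEquivalence _≈_
    ⊥ₐ ⊤ₐ   : Carrier
    _∨ₐ_ _∧ₐ_ : Carrier → Carrier → Carrier
    ¬ₐ ◇ₐ   : Carrier → Carrier

module _ {c ℓ} (A : RawCA c ℓ) where
  open RawCA A
  ⟦_⟧ : {X : Set} → Term X → (X → Carrier) → Carrier
  ⟦ var x ⟧ ρ = ρ x
  ⟦ `0 ⟧ ρ = ⊥ₐ
  ⟦ `1 ⟧ ρ = ⊤ₐ
  ⟦ t `∨ s ⟧ ρ = ⟦ t ⟧ ρ ∨ₐ ⟦ s ⟧ ρ
  ⟦ t `∧ s ⟧ ρ = ⟦ t ⟧ ρ ∧ₐ ⟦ s ⟧ ρ
  ⟦ `¬ t ⟧ ρ = ¬ₐ (⟦ t ⟧ ρ)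
  ⟦ `◇ t ⟧ ρ = ◇ₐ (⟦ t ⟧ ρ)

  Satisfies : (Term ℕ → Term ℕ → Set) → Set (c ⊔ ℓ)
  Satisfies E = ∀ t s → E t s → ∀ (ρ : ℕ → Carrier) → ⟦ t ⟧ ρ ≈ ⟦ s ⟧ ρ

record Hom {a ℓa b ℓb} (A : RawCA a ℓa) (B : RawCA b ℓb) : Set (a ⊔ ℓa ⊔ b ⊔ ℓb) where
  private
    module A = RawCA A
    module B = RawCA B
  field
    f       : A.Carrier → B.Carrier
    f-cong  : ∀ {x y} → x A.≈ y → f x B.≈ f y
    f-⊥     : f A.⊥ₐ B.≈ B.⊥ₐ
    f-⊤     : f A.⊤ₐ B.≈ B.⊤ₐ
    f-∨     : ∀ x y → f (x A.∨ₐ y) B.≈ (f x B.∨ₐ f y)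
    f-∧     : ∀ x y → f (x A.∧ₐ y) B.≈ (f x B.∧ₐ f y)
    f-¬     : ∀ x → f (A.¬ₐ x) B.≈ B.¬ₐ (f x)
    f-◇     : ∀ x → f (A.◇ₐ x) B.≈ B.◇ₐ (f x)

record Iso {a ℓa b ℓb} (A : RawCA a ℓa) (B : RawCA b ℓb) : Set (a ⊔ ℓa ⊔ b ⊔ ℓb) where
  private
    module A = RawCA A
    module B = RawCA B
  field
    hom       : Hom A B
  open Hom hom
  field
    injective  : ∀ {x y} → f x B.≈ f y → x A.≈ y
    surjective : ∀ y → Data.Product.Σ A.Carrier (λ x → f x B.≈ y)

record ClosureAlgebra c ℓ : Set (lsuc (c ⊔ ℓ)) where
  field
    ba : BooleanAlgebra c ℓ
  open BooleanAlgebra ba public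
  field
    ◇      : Carrier → Carrier
    ◇-cong : ∀ {x y} → x ≈ y → ◇ x ≈ ◇ y
    ◇-⊥    : ◇ ⊥ ≈ ⊥
    ◇-∨    : ∀ x y → ◇ (x ∨ y) ≈ (◇ x ∨ ◇ y)
    ≤-◇    : ∀ x → (x ∧ ◇ x) ≈ x          -- x ≤ ◇ x
    ◇-◇    : ∀ x → ◇ (◇ x) ≈ ◇ x

  raw : RawCA c ℓ
  raw = record
    { Carrier = Carrier ; _≈_ = _≈_ ; isEquiv = isEquivalence
    ; ⊥ₐ = ⊥ ; ⊤ₐ = ⊤ ; _∨ₐ_ = _∨_ ; _∧ₐ_ = _∧_ ; ¬ₐ = ¬_ ; ◇ₐ = ◇ }

-- A variety of closure algebras is presented by a set E of identities
-- (Birkhoff); its members are the closure algebras satisfying E.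

Identities : Set₁
Identities = Term ℕ → Term ℕ → Set

InV : Identities → ClosureAlgebra 0ℓ 0ℓ → Set
InV E A = Satisfies (ClosureAlgebra.raw A) E

VEq : Identities → {X : Set} → Term X → Term X → Set₁
VEq E t s = ∀ (A : ClosureAlgebra 0ℓ 0ℓ) → InV E A →
            ∀ (ρ : _ → ClosureAlgebra.Carrier A) →
            ClosureAlgebra._≈_ A (⟦ ClosureAlgebra.raw A ⟧ t ρ) (⟦ ClosureAlgebra.raw A ⟧ s ρ)

-- The congruence on the free algebra F_V(X) generated by a list of pairs
data Gen (E : Identities) {X : Set} (ps : List (Term X × Term X)) : Term X → Term X → Set₁ where
  base  : ∀ {t s} → VEq E t s → Gen E ps t s
  gen   : ∀ {t s} → (t , s) ∈ ps → Gen E ps t s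
  sym′  : ∀ {t s} → Gen E ps t s → Gen E ps s t
  trans′ : ∀ {t s u} → Gen E ps t s → Gen E ps s u → Gen E ps t u
  ∨-cong : ∀ {t t′ s s′} → Gen E ps t t′ → Gen E ps s s′ → Gen E ps (t `∨ s) (t′ `∨ s′)
  ∧-cong : ∀ {t t′ s s′} → Gen E ps t t′ → Gen E ps s s′ → Gen E ps (t `∧ s) (t′ `∧ s′)
  ¬-cong : ∀ {t t′} → Gen E ps t t′ → Gen E ps (`¬ t) (`¬ t′)
  ◇-cong : ∀ {t t′} → Gen E ps t t′ → Gen E ps (`◇ t) (`◇ t′)

Gen-refl : ∀ {E X ps} (t : Term X) → Gen E {X} ps t t
Gen-refl t = base (λ A _ ρ → ClosureAlgebra.refl A)

-- F_V(X)/θ(ps) as a setoid algebra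
Pres : Identities → (X : Set) → List (Term X × Term X) → RawCA 0ℓ (lsuc 0ℓ)
Pres E X ps = record
  { Carrier = Term X ; _≈_ = Gen E ps
  ; isEquiv = record { refl = Gen-refl _ ; sym = sym′ ; trans = trans′ }
  ; ⊥ₐ = `0 ; ⊤ₐ = `1 ; _∨ₐ_ = _`∨_ ; _∧ₐ_ = _`∧_ ; ¬ₐ = `¬ ; ◇ₐ = `◇ }

Free : Identities → (X : Set) → RawCA 0ℓ (lsuc 0ℓ)
Free E X = Pres E X Data.List.[]

FinitelyPresented : ∀ {c ℓ} → Identities → RawCA c ℓ → Set (c ⊔ ℓ ⊔ lsuc 0ℓ)
FinitelyPresented E A =
  Data.Product.Σ ℕ λ k → Data.Product.Σ (List (Term (Fin k) × Term (Fin k))) λ ps →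
    Iso A (Pres E (Fin k) ps)

Unifiable : ∀ {c ℓ} → Identities → RawCA c ℓ → Set (c ⊔ ℓ ⊔ lsuc 0ℓ)
Unifiable E A = Hom A (Free E ℕ)

-- The algebra 𝟒.  Elements encoded as pairs (x , y) = x·a ∨ y·¬a, so
-- 0 = (f,f), a = (t,f), ¬a = (f,t), 1 = (t,t).
-- ◇0 = 0, ◇a = 1, ◇¬a = ¬a, ◇1 = 1.

◇₄ : Bool × Bool → Bool × Bool
◇₄ (false , false) = (false , false)
◇₄ (true  , false) = (true , true)
◇₄ (false , true)  = (false , true)
◇₄ (true  , true)  = (true , true)

𝟒 : RawCA 0ℓ 0ℓ
𝟒 = record
  { Carrier = Bool × Bool ; _≈_ = _≡_ ; isEquiv = ≡-isEquivalence
  ; ⊥ₐ = (false , false) ; ⊤ₐ = (true , true)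
  ; _∨ₐ_ = λ p q → (proj₁ p or proj₁ q , proj₂ p or proj₂ q)
  ; _∧ₐ_ = λ p q → (proj₁ p and proj₁ q , proj₂ p and proj₂ q)
  ; ¬ₐ = λ p → (not (proj₁ p) , not (proj₂ p))
  ; ◇ₐ = ◇₄ }

_⊗_ : RawCA 0ℓ 0ℓ → RawCA 0ℓ 0ℓ → RawCA 0ℓ 0ℓ
A ⊗ B = record
  { Carrier = A.Carrier × B.Carrier
  ; _≈_ = λ p q → (proj₁ p A.≈ proj₁ q) × (proj₂ p B.≈ proj₂ q)
  ; isEquiv = record
      { refl = AE.refl , BE.refl
      ; sym = λ (x , y) → AE.sym x , BE.sym y
      ; trans = λ (x , y) (x′ , y′) → AE.trans x x′ , BE.trans y y′ }
  ; ⊥ₐ = A.⊥ₐ , B.⊥ₐ ; ⊤ₐ = A.⊤ₐ , B.⊤ₐ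
  ; _∨ₐ_ = λ p q → (proj₁ p A.∨ₐ proj₁ q) , (proj₂ p B.∨ₐ proj₂ q)
  ; _∧ₐ_ = λ p q → (proj₁ p A.∧ₐ proj₁ q) , (proj₂ p B.∧ₐ proj₂ q)
  ; ¬ₐ = λ p → A.¬ₐ (proj₁ p) , B.¬ₐ (proj₂ p)
  ; ◇ₐ = λ p → A.◇ₐ (proj₁ p) , B.◇ₐ (proj₂ p) }
  where
    module A = RawCA A
    module B = RawCA B
    module AE = IsEquivalence A.isEquiv
    module BE = IsEquivalence B.isEquiv

𝟒² : RawCA 0ℓ 0ℓ
𝟒² = 𝟒 ⊗ 𝟒

module Submission where

open import Defs
open import Level using (0ℓ)
open import Data.Bool using (Bool; true; false; not) renaming (_∨_ to _or_; _∧_ to _and_)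
open import Data.Bool.Properties using (∨-∧-isBooleanAlgebra)
open import Data.Nat using (ℕ)
open import Data.Fin using (Fin)
open import Data.Fin.Properties using (2↔Bool; *↔×)
open import Data.List using (List; _∷_; _++_; map; cartesianProductWith; allFin)
open import Data.List.Membership.Propositional using (_∈_)
open import Data.List.Membership.Propositional.Properties
  using (∈-map⁺; ∈-allFin; ∈-++⁺ˡ; ∈-++⁺ʳ; ∈-cartesianProductWith⁺)
open import Data.List.Relation.Unary.Any using (here; there)
open import Data.List.Relation.Unary.All as All using (All; _∷_; universal)
open import Data.List.Relation.Unary.All.Properties using (++⁺; map⁺; cartesianProductWith⁺)
open import Data.Product using (Σ; _×_; _,_; proj₁; proj₂)
open import Data.Product.Function.NonDependent.Propositional using (_×-↔_)
open import Function using (_∘_)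
open import Function.Bundles using (_↔_; Inverse)
open import Function.Properties.Inverse using (↔-trans)
open import Algebra.Lattice.Structures using (IsBooleanAlgebra)
import Algebra.Lattice.Properties.BooleanAlgebra as BooleanAlgebraProperties
open import Relation.Binary using (IsEquivalence)
open import Relation.Binary.PropositionalEquality using (_≡_; refl; cong; cong₂; subst; setoid)

-- A finite algebra that is a subalgebra of a product of members of V is presented by its
-- operation table: one generator per element and one relation per table entry.  Every
-- homomorphism into a member of V satisfies the table, so a separating family of such
-- homomorphisms shows the presentation identifies nothing; it is onto because every term is
-- built from generators.  𝟒² is separated by its two projections onto 𝟒 ∈ V.
-- For unifiability, 𝟒 maps onto 𝟐, and 𝟐 sits in the free algebra as the constants 0, 1.

module _ {A B : Set}
  {_∨₁_ _∧₁_ : A → A → A} {¬₁ : A → A} {⊤₁ ⊥₁ : A}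
  {_∨₂_ _∧₂_ : B → B → B} {¬₂ : B → B} {⊤₂ ⊥₂ : B}
  (BA₁ : IsBooleanAlgebra _≡_ _∨₁_ _∧₁_ ¬₁ ⊤₁ ⊥₁)
  (BA₂ : IsBooleanAlgebra _≡_ _∨₂_ _∧₂_ ¬₂ ⊤₂ ⊥₂) where

  private
    module B₁ = IsBooleanAlgebra BA₁
    module B₂ = IsBooleanAlgebra BA₂

    pointwise₁ : {L₁ R₁ : A → A} {L₂ R₂ : B → B} →
                 (∀ a → L₁ a ≡ R₁ a) → (∀ b → L₂ b ≡ R₂ b) →
                 ∀ p → (L₁ (proj₁ p) , L₂ (proj₂ p)) ≡ (R₁ (proj₁ p) , R₂ (proj₂ p))
    pointwise₁ e₁ e₂ p = cong₂ _,_ (e₁ (proj₁ p)) (e₂ (proj₂ p))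

    pointwise₂ : {L₁ R₁ : A → A → A} {L₂ R₂ : B → B → B} →
                 (∀ a a′ → L₁ a a′ ≡ R₁ a a′) → (∀ b b′ → L₂ b b′ ≡ R₂ b b′) →
                 ∀ p q → (L₁ (proj₁ p) (proj₁ q) , L₂ (proj₂ p) (proj₂ q))
                       ≡ (R₁ (proj₁ p) (proj₁ q) , R₂ (proj₂ p) (proj₂ q))
    pointwise₂ e₁ e₂ p q = cong₂ _,_ (e₁ (proj₁ p) (proj₁ q)) (e₂ (proj₂ p) (proj₂ q))

    pointwise₃ : {L₁ R₁ : A → A → A → A} {L₂ R₂ : B → B → B → B} →
                 (∀ a a′ a″ → L₁ a a′ a″ ≡ R₁ a a′ a″) → (∀ b b′ b″ → L₂ b b′ b″ ≡ R₂ b b′ b″) →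
                 ∀ p q r → (L₁ (proj₁ p) (proj₁ q) (proj₁ r) , L₂ (proj₂ p) (proj₂ q) (proj₂ r))
                         ≡ (R₁ (proj₁ p) (proj₁ q) (proj₁ r) , R₂ (proj₂ p) (proj₂ q) (proj₂ r))
    pointwise₃ e₁ e₂ p q r = cong₂ _,_ (e₁ (proj₁ p) (proj₁ q) (proj₁ r)) (e₂ (proj₂ p) (proj₂ q) (proj₂ r))

  ×-isBooleanAlgebra :
    IsBooleanAlgebra {A = A × B} _≡_
      (λ p q → (proj₁ p ∨₁ proj₁ q , proj₂ p ∨₂ proj₂ q))
      (λ p q → (proj₁ p ∧₁ proj₁ q , proj₂ p ∧₂ proj₂ q))
      (λ p → (¬₁ (proj₁ p) , ¬₂ (proj₂ p)))
      (⊤₁ , ⊤₂) (⊥₁ , ⊥₂)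
  ×-isBooleanAlgebra = record
    { isDistributiveLattice = record
      { isLattice = record
        { isEquivalence = Relation.Binary.PropositionalEquality.isEquivalence
        ; ∨-comm = pointwise₂ B₁.∨-comm B₂.∨-comm
        ; ∨-assoc = pointwise₃ B₁.∨-assoc B₂.∨-assoc
        ; ∨-cong = cong₂ _
        ; ∧-comm = pointwise₂ B₁.∧-comm B₂.∧-comm
        ; ∧-assoc = pointwise₃ B₁.∧-assoc B₂.∧-assoc
        ; ∧-cong = cong₂ _
        ; absorptive = pointwise₂ (proj₁ B₁.absorptive) (proj₁ B₂.absorptive)
                     , pointwise₂ (proj₂ B₁.absorptive) (proj₂ B₂.absorptive)
        }
      ; ∨-distrib-∧ = pointwise₃ (proj₁ B₁.∨-distrib-∧) (proj₁ B₂.∨-distrib-∧)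
                    , pointwise₃ (proj₂ B₁.∨-distrib-∧) (proj₂ B₂.∨-distrib-∧)
      ; ∧-distrib-∨ = pointwise₃ (proj₁ B₁.∧-distrib-∨) (proj₁ B₂.∧-distrib-∨)
                    , pointwise₃ (proj₂ B₁.∧-distrib-∨) (proj₂ B₂.∧-distrib-∨)
      }
    ; ∨-complement = pointwise₁ (proj₁ B₁.∨-complement) (proj₁ B₂.∨-complement)
                   , pointwise₁ (proj₂ B₁.∨-complement) (proj₂ B₂.∨-complement)
    ; ∧-complement = pointwise₁ (proj₁ B₁.∧-complement) (proj₁ B₂.∧-complement)
                   , pointwise₁ (proj₂ B₁.∧-complement) (proj₂ B₂.∧-complement)
    ; ¬-cong = cong (λ p → (¬₁ (proj₁ p) , ¬₂ (proj₂ p)))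
    }

_∘-hom_ : ∀ {a ℓa b ℓb c ℓc} {A : RawCA a ℓa} {B : RawCA b ℓb} {C : RawCA c ℓc} →
          Hom B C → Hom A B → Hom A C
_∘-hom_ {C = C} g h = record
  { f      = λ x → G.f (H.f x)
  ; f-cong = λ x≈y → G.f-cong (H.f-cong x≈y)
  ; f-⊥    = trans (G.f-cong H.f-⊥) G.f-⊥
  ; f-⊤    = trans (G.f-cong H.f-⊤) G.f-⊤
  ; f-∨    = λ x y → trans (G.f-cong (H.f-∨ x y)) (G.f-∨ (H.f x) (H.f y))
  ; f-∧    = λ x y → trans (G.f-cong (H.f-∧ x y)) (G.f-∧ (H.f x) (H.f y))
  ; f-¬    = λ x → trans (G.f-cong (H.f-¬ x)) (G.f-¬ (H.f x))
  ; f-◇    = λ x → trans (G.f-cong (H.f-◇ x)) (G.f-◇ (H.f x))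
  }
  where
    module G = Hom g
    module H = Hom h
    open IsEquivalence (RawCA.isEquiv C)

module _ (A B : RawCA 0ℓ 0ℓ) where
  private
    module A = RawCA A
    module B = RawCA B
    open IsEquivalence A.isEquiv renaming (refl to A-refl)
    open IsEquivalence B.isEquiv renaming (refl to B-refl)

  proj₁-hom : Hom (A ⊗ B) A
  proj₁-hom = record
    { f = proj₁ ; f-cong = proj₁ ; f-⊥ = A-refl ; f-⊤ = A-refl
    ; f-∨ = λ _ _ → A-refl ; f-∧ = λ _ _ → A-refl ; f-¬ = λ _ → A-refl ; f-◇ = λ _ → A-refl }

  proj₂-hom : Hom (A ⊗ B) B
  proj₂-hom = record
    { f = proj₂ ; f-cong = proj₂ ; f-⊥ = B-refl ; f-⊤ = B-refl
    ; f-∨ = λ _ _ → B-refl ; f-∧ = λ _ _ → B-refl ; f-¬ = λ _ → B-refl ; f-◇ = λ _ → B-refl }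

𝟐 : RawCA 0ℓ 0ℓ
𝟐 = record
  { Carrier = Bool ; _≈_ = _≡_ ; isEquiv = Relation.Binary.PropositionalEquality.isEquivalence
  ; ⊥ₐ = false ; ⊤ₐ = true ; _∨ₐ_ = _or_ ; _∧ₐ_ = _and_ ; ¬ₐ = not ; ◇ₐ = λ b → b }

-- The ultrafilter generated by the atom a; it commutes with ◇ because ◇¬a = ¬a.
𝟒→𝟐 : Hom 𝟒 𝟐
𝟒→𝟐 = record
  { f = proj₁ ; f-cong = cong proj₁ ; f-⊥ = refl ; f-⊤ = refl
  ; f-∨ = λ _ _ → refl ; f-∧ = λ _ _ → refl ; f-¬ = λ _ → refl ; f-◇ = proj₁-◇₄ }
  where
    proj₁-◇₄ : ∀ x → proj₁ (◇₄ x) ≡ proj₁ x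
    proj₁-◇₄ (false , false) = refl
    proj₁-◇₄ (false , true)  = refl
    proj₁-◇₄ (true  , false) = refl
    proj₁-◇₄ (true  , true)  = refl

truth-value : {X : Set} → Bool → Term X
truth-value false = `0
truth-value true  = `1

module _ (A : ClosureAlgebra 0ℓ 0ℓ) {X : Set} (ρ : X → ClosureAlgebra.Carrier A) where
  open ClosureAlgebra A
  open BooleanAlgebraProperties ba
    using (¬⊥≈⊤; ¬⊤≈⊥; ∧-identityˡ; ∨-identityˡ; ∨-identityʳ; ∧-zeroˡ; ∧-zeroʳ; ∨-idem; ∧-idem)

  private
    ⟦_⟧ₐ : Term X → Carrier
    ⟦ t ⟧ₐ = ⟦ raw ⟧ t ρ

  ◇-⊤ : ◇ ⊤ ≈ ⊤
  ◇-⊤ = trans (sym (∧-identityˡ (◇ ⊤))) (≤-◇ ⊤)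

  truth-value-∨ : ∀ a b → ⟦ truth-value (a or b) ⟧ₐ ≈ ⟦ truth-value a ⟧ₐ ∨ ⟦ truth-value b ⟧ₐ
  truth-value-∨ false false = sym (∨-idem ⊥)
  truth-value-∨ false true  = sym (∨-identityˡ ⊤)
  truth-value-∨ true  false = sym (∨-identityʳ ⊤)
  truth-value-∨ true  true  = sym (∨-idem ⊤)

  truth-value-∧ : ∀ a b → ⟦ truth-value (a and b) ⟧ₐ ≈ ⟦ truth-value a ⟧ₐ ∧ ⟦ truth-value b ⟧ₐ
  truth-value-∧ false false = sym (∧-idem ⊥)
  truth-value-∧ false true  = sym (∧-zeroˡ ⊤)
  truth-value-∧ true  false = sym (∧-zeroʳ ⊤)
  truth-value-∧ true  true  = sym (∧-idem ⊤)

  truth-value-¬ : ∀ a → ⟦ truth-value (not a) ⟧ₐ ≈ ¬ ⟦ truth-value a ⟧ₐ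
  truth-value-¬ false = sym ¬⊥≈⊤
  truth-value-¬ true  = sym ¬⊤≈⊥

  truth-value-◇ : ∀ a → ⟦ truth-value a ⟧ₐ ≈ ◇ ⟦ truth-value a ⟧ₐ
  truth-value-◇ false = sym ◇-⊥
  truth-value-◇ true  = sym ◇-⊤

𝟐→Free : (E : Identities) (X : Set) → Hom 𝟐 (Free E X)
𝟐→Free E X = record
  { f = truth-value ; f-cong = λ { refl → Gen-refl _ } ; f-⊥ = Gen-refl _ ; f-⊤ = Gen-refl _
  ; f-∨ = λ a b → base λ A _ ρ → truth-value-∨ A ρ a b
  ; f-∧ = λ a b → base λ A _ ρ → truth-value-∧ A ρ a b
  ; f-¬ = λ a → base λ A _ ρ → truth-value-¬ A ρ a
  ; f-◇ = λ a → base λ A _ ρ → truth-value-◇ A ρ a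
  }

HoldsUnder : (B : ClosureAlgebra 0ℓ 0ℓ) {X : Set} → (X → ClosureAlgebra.Carrier B) → Term X × Term X → Set
HoldsUnder B ρ (t , s) = ⟦ raw ⟧ t ρ ≈ ⟦ raw ⟧ s ρ
  where open ClosureAlgebra B

module _ (E : Identities) {X : Set} {ps : List (Term X × Term X)} where

  module _ (B : ClosureAlgebra 0ℓ 0ℓ) (B∈V : InV E B) (ρ : X → ClosureAlgebra.Carrier B) where
    private module B = ClosureAlgebra B

    Gen-sound : All (HoldsUnder B ρ) ps → ∀ {t s} → Gen E ps t s → HoldsUnder B ρ (t , s)
    Gen-sound hold (base t≈s)   = t≈s B B∈V ρ
    Gen-sound hold (gen t,s∈ps) = All.lookup hold t,s∈ps
    Gen-sound hold (sym′ p)     = B.sym (Gen-sound hold p)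
    Gen-sound hold (trans′ p q) = B.trans (Gen-sound hold p) (Gen-sound hold q)
    Gen-sound hold (∨-cong p q) = B.∨-cong (Gen-sound hold p) (Gen-sound hold q)
    Gen-sound hold (∧-cong p q) = B.∧-cong (Gen-sound hold p) (Gen-sound hold q)
    Gen-sound hold (¬-cong p)   = B.¬-cong (Gen-sound hold p)
    Gen-sound hold (◇-cong p)   = B.◇-cong (Gen-sound hold p)

  module _ {a ℓ} {A : RawCA a ℓ} (h : Hom A (Pres E X ps)) where
    open RawCA A
    open Hom h

    Pres-hom-surjective : (∀ i → Σ Carrier λ x → Gen E ps (f x) (var i)) →
                          ∀ t → Σ Carrier λ x → Gen E ps (f x) t
    Pres-hom-surjective onto (var i) = onto i
    Pres-hom-surjective onto `0 = ⊥ₐ , f-⊥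
    Pres-hom-surjective onto `1 = ⊤ₐ , f-⊤
    Pres-hom-surjective onto (t `∨ s) with Pres-hom-surjective onto t | Pres-hom-surjective onto s
    ... | x , fx≈t | y , fy≈s = x ∨ₐ y , trans′ (f-∨ x y) (∨-cong fx≈t fy≈s)
    Pres-hom-surjective onto (t `∧ s) with Pres-hom-surjective onto t | Pres-hom-surjective onto s
    ... | x , fx≈t | y , fy≈s = x ∧ₐ y , trans′ (f-∧ x y) (∧-cong fx≈t fy≈s)
    Pres-hom-surjective onto (`¬ t) with Pres-hom-surjective onto t
    ... | x , fx≈t = ¬ₐ x , trans′ (f-¬ x) (¬-cong fx≈t)
    Pres-hom-surjective onto (`◇ t) with Pres-hom-surjective onto t
    ... | x , fx≈t = ◇ₐ x , trans′ (f-◇ x) (◇-cong fx≈t)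

≡⇒Gen : ∀ {E X ps} {t s : Term X} → t ≡ s → Gen E ps t s
≡⇒Gen refl = Gen-refl _

-- Witnesses that A is (isomorphic to) a subalgebra of a product of members of V.
record SeparatingFamily (E : Identities) (A : RawCA 0ℓ 0ℓ) : Set₁ where
  field
    Index     : Set
    algebra   : Index → ClosureAlgebra 0ℓ 0ℓ
    algebra∈V : ∀ i → InV E (algebra i)
    hom       : ∀ i → Hom A (ClosureAlgebra.raw (algebra i))
    separates : ∀ {x y} → (∀ i → ClosureAlgebra._≈_ (algebra i) (Hom.f (hom i) x) (Hom.f (hom i) y)) →
                RawCA._≈_ A x y

module OperationTable {A : RawCA 0ℓ 0ℓ} {n : ℕ} (enum : Fin n ↔ RawCA.Carrier A) where
  open RawCA A
  open Inverse enum using (to; from; strictlyInverseˡ; strictlyInverseʳ)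

  generator : Carrier → Term (Fin n)
  generator x = var (from x)

  elements : List Carrier
  elements = map to (allFin n)

  ∈-elements : ∀ x → x ∈ elements
  ∈-elements x = subst (_∈ elements) (strictlyInverseˡ x) (∈-map⁺ to (∈-allFin (from x)))

  ∨-relation ∧-relation : Carrier → Carrier → Term (Fin n) × Term (Fin n)
  ∨-relation x y = generator (x ∨ₐ y) , generator x `∨ generator y
  ∧-relation x y = generator (x ∧ₐ y) , generator x `∧ generator y

  ¬-relation ◇-relation : Carrier → Term (Fin n) × Term (Fin n)
  ¬-relation x = generator (¬ₐ x) , `¬ (generator x)
  ◇-relation x = generator (◇ₐ x) , `◇ (generator x)

  ∨-table ∧-table ¬-table ◇-table : List (Term (Fin n) × Term (Fin n))
  ∨-table = cartesianProductWith ∨-relation elements elements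
  ∧-table = cartesianProductWith ∧-relation elements elements
  ¬-table = map ¬-relation elements
  ◇-table = map ◇-relation elements

  relations : List (Term (Fin n) × Term (Fin n))
  relations = (generator ⊥ₐ , `0) ∷ (generator ⊤ₐ , `1) ∷ ∨-table ++ ∧-table ++ ¬-table ++ ◇-table

  module _ (B : ClosureAlgebra 0ℓ 0ℓ) (h : Hom A (ClosureAlgebra.raw B)) where
    private module B = ClosureAlgebra B
    open Hom h

    generator-value : ∀ x → ⟦ B.raw ⟧ (generator x) (f ∘ to) B.≈ f x
    generator-value x = B.reflexive (cong f (strictlyInverseˡ x))

    relations-hold : All (HoldsUnder B (f ∘ to)) relations
    relations-hold =
      ⊥-holds ∷ ⊤-holds ∷
      ++⁺ (cartesianProductWith⁺ (setoid _) (setoid _) ∨-relation elements elements (λ _ _ → ∨-holds _ _))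
      (++⁺ (cartesianProductWith⁺ (setoid _) (setoid _) ∧-relation elements elements (λ _ _ → ∧-holds _ _))
      (++⁺ (map⁺ (universal ¬-holds elements)) (map⁺ (universal ◇-holds elements))))
      where
        ⊥-holds : HoldsUnder B (f ∘ to) (generator ⊥ₐ , `0)
        ⊥-holds = B.trans (generator-value ⊥ₐ) f-⊥
        ⊤-holds : HoldsUnder B (f ∘ to) (generator ⊤ₐ , `1)
        ⊤-holds = B.trans (generator-value ⊤ₐ) f-⊤
        ∨-holds : ∀ x y → HoldsUnder B (f ∘ to) (∨-relation x y)
        ∨-holds x y = B.trans (generator-value (x ∨ₐ y)) (B.trans (f-∨ x y) (B.sym (B.∨-cong (generator-value x) (generator-value y))))
        ∧-holds : ∀ x y → HoldsUnder B (f ∘ to) (∧-relation x y)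
        ∧-holds x y = B.trans (generator-value (x ∧ₐ y)) (B.trans (f-∧ x y) (B.sym (B.∧-cong (generator-value x) (generator-value y))))
        ¬-holds : ∀ x → HoldsUnder B (f ∘ to) (¬-relation x)
        ¬-holds x = B.trans (generator-value (¬ₐ x)) (B.trans (f-¬ x) (B.sym (B.¬-cong (generator-value x))))
        ◇-holds : ∀ x → HoldsUnder B (f ∘ to) (◇-relation x)
        ◇-holds x = B.trans (generator-value (◇ₐ x)) (B.trans (f-◇ x) (B.sym (B.◇-cong (generator-value x))))

  module _ (E : Identities) where

    generator-hom : (∀ {x y} → x ≈ y → x ≡ y) → Hom A (Pres E (Fin n) relations)
    generator-hom ≈⇒≡ = record
      { f      = generator
      ; f-cong = λ x≈y → ≡⇒Gen (cong generator (≈⇒≡ x≈y))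
      ; f-⊥    = gen (here refl)
      ; f-⊤    = gen (there (here refl))
      ; f-∨    = λ x y → gen (there (there (∈-++⁺ˡ (∈-∨-table x y))))
      ; f-∧    = λ x y → gen (there (there (∈-++⁺ʳ ∨-table (∈-++⁺ˡ (∈-∧-table x y)))))
      ; f-¬    = λ x → gen (there (there (∈-++⁺ʳ ∨-table (∈-++⁺ʳ ∧-table (∈-++⁺ˡ (∈-map⁺ ¬-relation (∈-elements x)))))))
      ; f-◇    = λ x → gen (there (there (∈-++⁺ʳ ∨-table (∈-++⁺ʳ ∧-table (∈-++⁺ʳ ¬-table (∈-map⁺ ◇-relation (∈-elements x)))))))
      }
      where
        ∈-∨-table : ∀ x y → ∨-relation x y ∈ ∨-table
        ∈-∨-table x y = ∈-cartesianProductWith⁺ ∨-relation (∈-elements x) (∈-elements y)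
        ∈-∧-table : ∀ x y → ∧-relation x y ∈ ∧-table
        ∈-∧-table x y = ∈-cartesianProductWith⁺ ∧-relation (∈-elements x) (∈-elements y)

    generator-injective : SeparatingFamily E A → ∀ {x y} → Gen E relations (generator x) (generator y) → x ≈ y
    generator-injective family {x} {y} gx≈gy = separates λ i →
      let module B = ClosureAlgebra (algebra i) in
      B.trans (B.sym (generator-value (algebra i) (hom i) x))
        (B.trans (Gen-sound E (algebra i) (algebra∈V i) _ (relations-hold (algebra i) (hom i)) gx≈gy)
          (generator-value (algebra i) (hom i) y))
      where open SeparatingFamily family

    finitelyPresented : (∀ {x y} → x ≈ y → x ≡ y) → SeparatingFamily E A → FinitelyPresented E A
    finitelyPresented ≈⇒≡ family = n , relations , record
      { hom        = generator-hom ≈⇒≡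
      ; injective  = generator-injective family
      ; surjective = Pres-hom-surjective E (generator-hom ≈⇒≡) λ i → to i , ≡⇒Gen (cong var (strictlyInverseʳ i))
      }

◇₄-∨ : ∀ x y → ◇₄ (RawCA._∨ₐ_ 𝟒 x y) ≡ RawCA._∨ₐ_ 𝟒 (◇₄ x) (◇₄ y)
◇₄-∨ (false , false) y               = refl
◇₄-∨ (true  , true)  y               = refl
◇₄-∨ (true  , false) (false , false) = refl
◇₄-∨ (true  , false) (false , true)  = refl
◇₄-∨ (true  , false) (true  , false) = refl
◇₄-∨ (true  , false) (true  , true)  = refl
◇₄-∨ (false , true)  (false , false) = refl
◇₄-∨ (false , true)  (false , true)  = refl
◇₄-∨ (false , true)  (true  , false) = refl
◇₄-∨ (false , true)  (true  , true)  = refl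

≤-◇₄ : ∀ x → RawCA._∧ₐ_ 𝟒 x (◇₄ x) ≡ x
≤-◇₄ (false , false) = refl
≤-◇₄ (false , true)  = refl
≤-◇₄ (true  , false) = refl
≤-◇₄ (true  , true)  = refl

◇₄-idem : ∀ x → ◇₄ (◇₄ x) ≡ ◇₄ x
◇₄-idem (false , false) = refl
◇₄-idem (false , true)  = refl
◇₄-idem (true  , false) = refl
◇₄-idem (true  , true)  = refl

-- Equality is ≡ on pairs rather than pointwise, so that the underlying raw algebra is 𝟒 itself.
𝟒-closureAlgebra : ClosureAlgebra 0ℓ 0ℓ
𝟒-closureAlgebra = record
  { ba = record { isBooleanAlgebra = ×-isBooleanAlgebra ∨-∧-isBooleanAlgebra ∨-∧-isBooleanAlgebra }
  ; ◇ = ◇₄ ; ◇-cong = cong ◇₄ ; ◇-⊥ = refl ; ◇-∨ = ◇₄-∨ ; ≤-◇ = ≤-◇₄ ; ◇-◇ = ◇₄-idem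
  }

Fin4↔Bool² : Fin 4 ↔ (Bool × Bool)
Fin4↔Bool² = ↔-trans (*↔× {2} {2}) (2↔Bool ×-↔ 2↔Bool)

Fin16↔𝟒² : Fin 16 ↔ RawCA.Carrier 𝟒²
Fin16↔𝟒² = ↔-trans (*↔× {4} {4}) (Fin4↔Bool² ×-↔ Fin4↔Bool²)

𝟒²-discrete : ∀ {x y} → RawCA._≈_ 𝟒² x y → x ≡ y
𝟒²-discrete (x₁≡y₁ , x₂≡y₂) = cong₂ _,_ x₁≡y₁ x₂≡y₂

𝟒²-separated : (E : Identities) → Satisfies 𝟒 E → SeparatingFamily E 𝟒²
𝟒²-separated E 𝟒∈V = record
  { Index     = Bool
  ; algebra   = λ _ → 𝟒-closureAlgebra
  ; algebra∈V = λ _ → 𝟒∈V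
  ; hom       = λ { true → proj₁-hom 𝟒 𝟒 ; false → proj₂-hom 𝟒 𝟒 }
  ; separates = λ agree → agree true , agree false
  }

𝟒²-unifiable : (E : Identities) → Unifiable E 𝟒²
𝟒²-unifiable E = 𝟐→Free E ℕ ∘-hom (𝟒→𝟐 ∘-hom proj₁-hom 𝟒 𝟒)

lemma8p9 : (E : Identities) → Satisfies 𝟒 E →
           FinitelyPresented E 𝟒² × Unifiable E 𝟒²
lemma8p9 E 𝟒∈V =
    OperationTable.finitelyPresented Fin16↔𝟒² E 𝟒²-discrete (𝟒²-separated E 𝟒∈V)
  , 𝟒²-unifiable E
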